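{- Let $A,B,C$ be finite sets of real numbers with $\max\{|A|,|B|\}\le|C|\le|A|+|B|$. Then the number of triples $(a,b,c)\in A\times B\times C$ satisfying $a+b=c$ is at most $|A||B|-\frac14(|A|+|B|-|C|)^2+\frac14$. -}

module Defs where

open import Level using (0ℓ)
open import Data.Nat using (ℕ; _+_; _*_; _∸_; _^_; _≤_)
open import Data.Product using (_×_; _,_; ∃; ∃-syntax)
open import Data.List using (List; length)
open import Data.List.Membership.Propositional using (_∈_)
open import Data.List.Relation.Unary.All using (All)
open import Data.List.Relation.Unary.Unique.Propositional using (Unique)
open import Relation.Binary.PropositionalEquality using (_≡_)
open import Relation.Binary.Structures using (IsStrictTotalOrder)
open import Relation.Nullary using (¬_)
open import Data.Sum using (_⊎_)
open import Algebra.Structures using (IsCommutativeRing)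

-- The real numbers, axiomatised as a (Dedekind-)complete ordered field.
-- Any model is isomorphic to ℝ, so quantifying over all models is
-- the same as speaking about ℝ.
record RealNumbers : Set₁ where
  infixl 6 _+ᵣ_
  infixl 7 _*ᵣ_
  infix 4 _<ᵣ_ _≤ᵣ_
  field
    ℝ     : Set
    _+ᵣ_  : ℝ → ℝ → ℝ
    _*ᵣ_  : ℝ → ℝ → ℝ
    -ᵣ_   : ℝ → ℝ
    0ᵣ 1ᵣ : ℝ
    _<ᵣ_  : ℝ → ℝ → Set
    isCommutativeRing : IsCommutativeRing _≡_ _+ᵣ_ _*ᵣ_ -ᵣ_ 0ᵣ 1ᵣ
    0≢1       : ¬ (0ᵣ ≡ 1ᵣ)
    inverse   : ∀ x → ¬ (x ≡ 0ᵣ) → ∃[ y ] (x *ᵣ y ≡ 1ᵣ)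
    isStrictTotalOrder : IsStrictTotalOrder _≡_ _<ᵣ_
    +-mono-<  : ∀ x y z → x <ᵣ y → x +ᵣ z <ᵣ y +ᵣ z
    *-pos     : ∀ x y → 0ᵣ <ᵣ x → 0ᵣ <ᵣ y → 0ᵣ <ᵣ x *ᵣ y

  _≤ᵣ_ : ℝ → ℝ → Set
  x ≤ᵣ y = x <ᵣ y ⊎ x ≡ y

  field
    complete : (P : ℝ → Set) → ∃ P → (∃[ u ] (∀ x → P x → x ≤ᵣ u)) →
               ∃[ s ] ((∀ x → P x → x ≤ᵣ s) ×
                       (∀ u → (∀ x → P x → x ≤ᵣ u) → s ≤ᵣ u))

-- A finite set of reals is a duplicate-free list; its cardinality is the length.
-- "The number of triples (a,b,c) ∈ A×B×C with a+b=c is at most N" is expressed as: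
-- every duplicate-free list of such triples has length at most N.
module _ (R : RealNumbers) where
  open RealNumbers R

  IsSumTriple : List ℝ → List ℝ → List ℝ → ℝ × ℝ × ℝ → Set
  IsSumTriple A B C (a , b , c) = a ∈ A × b ∈ B × c ∈ C × a +ᵣ b ≡ c

{-# OPTIONS --safe #-}
-- Let a₀ = min A and b₀ = max B. A sum triple with a = a₀ or b = b₀ is determined by its sum c:
-- a₀ + b = a + b₀ with a₀ ≤ a and b ≤ b₀ forces a = a₀ and b = b₀. So at most |C| triples
-- involve a₀ or b₀, and the others are sum triples T′ of A ∖ {a₀}, B ∖ {b₀}, C, whose excess
-- k′ = |A| + |B| − 2 − |C| is two less than k. Then
--   4|T| + k² ≤ (4|T′| + k′²) + 4(|C| + k′) + 4 ≤ 4(|A| − 1)(|B| − 1) + 1 + 4(|A| + |B| − 2) + 4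
--           = 4|A||B| + 1
-- by induction. Once k ≤ 1 the trivial bound |T| ≤ |A||B| suffices.
module Submission where

open import Data.Empty using (⊥-elim)
open import Data.Fin using (Fin; zero; suc)
open import Data.Fin.Properties using (injective⇒≤)
open import Data.List using (List; []; _∷_; length; lookup; filter; map; _++_; cartesianProduct)
open import Data.List.Properties using (length-++; length-map; length-removeAt′)
open import Data.List.Membership.Propositional using (_∈_)
open import Data.List.Membership.Propositional.Properties
  using (∈-lookup; ∈-filter⁻; ∈-cartesianProduct⁺)
open import Data.List.Relation.Unary.Any using (Any; here; there; index; _─_)
open import Data.List.Relation.Unary.Any.Properties using (lookup-index)
open import Data.List.Relation.Unary.All as All using (All; []; _∷_)
open import Data.List.Relation.Unary.AllPairs using (_∷_)
open import Data.List.Relation.Unary.Unique.Propositional using (Unique)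
import Data.List.Relation.Unary.Unique.Propositional.Properties as Unique
import Data.List.Extrema as Extrema
open import Data.Nat using (suc; _+_; _*_; _∸_; _^_; _≤_; _<_; _⊔_; z≤n; s≤s; _≤?_)
open import Data.Nat.Properties
  using (≤-trans; ≤-reflexive; n≤1+n; +-suc; +-comm; +-mono-≤; +-monoˡ-≤; +-monoʳ-≤; *-monoʳ-≤;
         ^-monoˡ-≤; ⊔-mono-≤; m≤n⇒m≤n+o; ≰⇒>; m≤n+o⇒m∸n≤o; m+[n∸m]≡n; +-∸-assoc; suc-injective;
         module ≤-Reasoning)
open import Data.Nat.Solver using (module +-*-Solver)
open import Data.Product using (_×_; _,_; proj₁; proj₂)
open import Data.Sum using (_⊎_; inj₁; inj₂; [_,_]′)
open import Function using (Injective)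
open import Relation.Binary.Bundles using (StrictTotalOrder; DecTotalOrder)
open import Relation.Binary.Definitions using (tri<; tri≈; tri>)
open import Relation.Binary.Structures using (IsStrictTotalOrder)
import Relation.Binary.Properties.StrictTotalOrder as StrictTotalOrderProperties
open import Relation.Binary.PropositionalEquality
open import Relation.Nullary using (¬_; yes; no)
open import Relation.Nullary.Decidable using (_⊎-dec_)
open import Relation.Unary using (Pred; Decidable)
open import Relation.Unary.Properties using (∁?)
open import Algebra.Structures using (IsCommutativeRing)
open import Level using (Level)

open import Defs

private
  variable
    ℓ : Level
    X Y : Set
    x y : X
    xs ys : List X

lookup-injective : Unique xs → ∀ {i j} → lookup xs i ≡ lookup xs j → i ≡ j
lookup-injective (_  ∷ _)  {zero}  {zero}  _  = refl
lookup-injective (x∉ ∷ _)  {zero}  {suc j} eq = ⊥-elim (All.lookup x∉ (∈-lookup j) eq)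
lookup-injective (x∉ ∷ _)  {suc i} {zero}  eq = ⊥-elim (All.lookup x∉ (∈-lookup i) (sym eq))
lookup-injective (_  ∷ xs) {suc i} {suc j} eq = cong suc (lookup-injective xs eq)

injectiveOn⇒length≤ : (f : X → Y) → Unique xs → (∀ {x} → x ∈ xs → f x ∈ ys) →
                      (∀ {x y} → x ∈ xs → y ∈ xs → f x ≡ f y → x ≡ y) → length xs ≤ length ys
injectiveOn⇒length≤ {xs = xs} {ys = ys} f xs-unique f∈ys f-inj = injective⇒≤ position-injective
  where
  position : Fin (length xs) → Fin (length ys)
  position i = index (f∈ys (∈-lookup i))

  position-injective : Injective _≡_ _≡_ position
  position-injective {i} {j} eq = lookup-injective xs-unique (f-inj (∈-lookup i) (∈-lookup j) (begin
    f (lookup xs i)         ≡⟨ lookup-index (f∈ys (∈-lookup i)) ⟩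
    lookup ys (position i)  ≡⟨ cong (lookup ys) eq ⟩
    lookup ys (position j)  ≡⟨ lookup-index (f∈ys (∈-lookup j)) ⟨
    f (lookup xs j)         ∎))
    where open ≡-Reasoning

length-cartesianProduct : (xs : List X) (ys : List Y) → length (cartesianProduct xs ys) ≡ length xs * length ys
length-cartesianProduct []       ys = refl
length-cartesianProduct (x ∷ xs) ys = begin
  length (map (x ,_) ys ++ cartesianProduct xs ys)        ≡⟨ length-++ (map (x ,_) ys) ⟩
  length (map (x ,_) ys) + length (cartesianProduct xs ys) ≡⟨ cong₂ _+_ (length-map (x ,_) ys) (length-cartesianProduct xs ys) ⟩
  length ys + length xs * length ys                        ∎
  where open ≡-Reasoning

length-filter+filter-∁ : {P : Pred X ℓ} (P? : Decidable P) (xs : List X) →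
                         length (filter P? xs) + length (filter (∁? P?) xs) ≡ length xs
length-filter+filter-∁ P? [] = refl
length-filter+filter-∁ P? (x ∷ xs) with P? x
... | yes _ = cong suc (length-filter+filter-∁ P? xs)
... | no  _ = trans (+-suc _ _) (cong suc (length-filter+filter-∁ P? xs))

length-─′ : {P : Pred X ℓ} (p : Any P xs) → length xs ≡ suc (length (xs ─ p))
length-─′ {xs = xs} p = length-removeAt′ xs (index p)

length-─-≤ : {P : Pred X ℓ} (p : Any P xs) → length (xs ─ p) ≤ length xs
length-─-≤ p = ≤-trans (n≤1+n _) (≤-reflexive (sym (length-─′ p)))

∈-─⁺ : (p : y ∈ xs) → x ∈ xs → ¬ x ≡ y → x ∈ (xs ─ p)
∈-─⁺ (here refl) (here refl) x≢y = ⊥-elim (x≢y refl)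
∈-─⁺ (here _)    (there x∈)  _   = x∈
∈-─⁺ (there _)   (here refl) _   = here refl
∈-─⁺ (there p)   (there x∈)  x≢y = there (∈-─⁺ p x∈ x≢y)

suc+suc≤+1 : ∀ {a b a′ b′ c} → a ≡ suc a′ → b ≡ suc b′ → a′ + b′ < c → a + b ≤ c + 1
suc+suc≤+1 {a′ = a′} {b′} {c} refl refl a′+b′<c = begin
  suc a′ + suc b′     ≡⟨ cong suc (+-suc a′ b′) ⟩
  suc (suc (a′ + b′)) ≤⟨ s≤s a′+b′<c ⟩
  suc c               ≡⟨ +-comm 1 c ⟩
  c + 1               ∎
  where open ≤-Reasoning

excess-step : ∀ {a b a′ b′ c t t′} → a ≡ suc a′ → b ≡ suc b′ → c ≤ a′ + b′ → t ≤ c + t′ →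
              4 * t′ + (a′ + b′ ∸ c) ^ 2 ≤ 4 * (a′ * b′) + 1 →
              4 * t + (a + b ∸ c) ^ 2 ≤ 4 * (a * b) + 1
excess-step {a′ = a′} {b′} {c} {t} {t′} refl refl c≤a′+b′ t≤c+t′ ih = begin
  4 * t + (suc a′ + suc b′ ∸ c) ^ 2          ≡⟨ cong (λ e → 4 * t + e ^ 2) excess≡2+k ⟩
  4 * t + (2 + k) ^ 2                         ≤⟨ +-monoˡ-≤ ((2 + k) ^ 2) (*-monoʳ-≤ 4 t≤c+t′) ⟩
  4 * (c + t′) + (2 + k) ^ 2                  ≡⟨ regroup c t′ k ⟩
  4 * (c + k) + 4 + (4 * t′ + k ^ 2)          ≤⟨ +-monoʳ-≤ (4 * (c + k) + 4) ih ⟩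
  4 * (c + k) + 4 + (4 * (a′ * b′) + 1)       ≡⟨ cong (λ s → 4 * s + 4 + (4 * (a′ * b′) + 1)) c+k≡a′+b′ ⟩
  4 * (a′ + b′) + 4 + (4 * (a′ * b′) + 1)     ≡⟨ expand a′ b′ ⟩
  4 * (suc a′ * suc b′) + 1                   ∎
  where
  open ≤-Reasoning
  open +-*-Solver
  k = a′ + b′ ∸ c
  c+k≡a′+b′ : c + k ≡ a′ + b′
  c+k≡a′+b′ = m+[n∸m]≡n c≤a′+b′
  excess≡2+k : suc a′ + suc b′ ∸ c ≡ 2 + k
  excess≡2+k = trans (cong (λ s → suc s ∸ c) (+-suc a′ b′)) (+-∸-assoc 2 c≤a′+b′)
  regroup : ∀ c t′ k → 4 * (c + t′) + (2 + k) ^ 2 ≡ 4 * (c + k) + 4 + (4 * t′ + k ^ 2)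
  regroup = solve 3 (λ c t′ k → con 4 :* (c :+ t′) :+ (con 2 :+ k) :^ 2
                              := con 4 :* (c :+ k) :+ con 4 :+ (con 4 :* t′ :+ k :^ 2)) refl
  expand : ∀ a′ b′ → 4 * (a′ + b′) + 4 + (4 * (a′ * b′) + 1) ≡ 4 * (suc a′ * suc b′) + 1
  expand = solve 2 (λ a′ b′ → con 4 :* (a′ :+ b′) :+ con 4 :+ (con 4 :* (a′ :* b′) :+ con 1)
                           := con 4 :* ((con 1 :+ a′) :* (con 1 :+ b′)) :+ con 1) refl

module _ (R : RealNumbers) where
  open RealNumbers R
  open IsStrictTotalOrder isStrictTotalOrder using (compare; irrefl; _≟_) renaming (trans to <-trans)
  open IsCommutativeRing isCommutativeRing using () renaming (+-comm to +ᵣ-comm)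

  Triple : Set
  Triple = ℝ × ℝ × ℝ

  private
    variable
      a b a′ b′ c a₀ b₀ : ℝ
      A B C : List ℝ
      T : List Triple

  +ᵣ-monoʳ-< : ∀ a → b <ᵣ b′ → a +ᵣ b <ᵣ a +ᵣ b′
  +ᵣ-monoʳ-< {b} {b′} a b<b′ = subst₂ _<ᵣ_ (+ᵣ-comm b a) (+ᵣ-comm b′ a) (+-mono-< b b′ a b<b′)

  +ᵣ-mono-<-≤ : a <ᵣ a′ → b ≤ᵣ b′ → a +ᵣ b <ᵣ a′ +ᵣ b′
  +ᵣ-mono-<-≤ {a} {a′} {b} a<a′ (inj₁ b<b′) = <-trans (+-mono-< a a′ b a<a′) (+ᵣ-monoʳ-< a′ b<b′)
  +ᵣ-mono-<-≤ {a} {a′} {b} a<a′ (inj₂ refl) = +-mono-< a a′ b a<a′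

  +ᵣ-cancelˡ : ∀ a → a +ᵣ b ≡ a +ᵣ b′ → b ≡ b′
  +ᵣ-cancelˡ {b} {b′} a eq with compare b b′
  ... | tri< b<b′ _ _ = ⊥-elim (irrefl eq (+ᵣ-monoʳ-< a b<b′))
  ... | tri≈ _ b≡b′ _ = b≡b′
  ... | tri> _ _ b>b′ = ⊥-elim (irrefl (sym eq) (+ᵣ-monoʳ-< a b>b′))

  +ᵣ-cancelʳ : ∀ b → a +ᵣ b ≡ a′ +ᵣ b → a ≡ a′
  +ᵣ-cancelʳ {a} {a′} b eq = +ᵣ-cancelˡ b (trans (+ᵣ-comm b a) (trans eq (+ᵣ-comm a′ b)))

  +ᵣ-≡-squeeze : a ≤ᵣ a′ → b ≤ᵣ b′ → a +ᵣ b ≡ a′ +ᵣ b′ → a ≡ a′ × b ≡ b′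
  +ᵣ-≡-squeeze (inj₂ refl) _     eq = refl , +ᵣ-cancelˡ _ eq
  +ᵣ-≡-squeeze (inj₁ a<a′) b≤b′ eq = ⊥-elim (irrefl eq (+ᵣ-mono-<-≤ a<a′ b≤b′))

  <ᵣ-strictTotalOrder : StrictTotalOrder _ _ _
  <ᵣ-strictTotalOrder = record { isStrictTotalOrder = isStrictTotalOrder }

  open DecTotalOrder (StrictTotalOrderProperties.decTotalOrder <ᵣ-strictTotalOrder) using (totalOrder)
  open Extrema totalOrder using (min; max; argmin-sel; argmax-sel; min≤⊤; min≤xs; ⊥≤max; xs≤max)

  min-∈ : ∀ a A → min a A ∈ a ∷ A
  min-∈ a A = [ here , there ]′ (argmin-sel (λ x → x) a A)

  min-≤ : ∀ a A → All (min a A ≤ᵣ_) (a ∷ A)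
  min-≤ a A = min≤⊤ a A ∷ min≤xs a A

  max-∈ : ∀ b B → max b B ∈ b ∷ B
  max-∈ b B = [ here , there ]′ (argmax-sel (λ x → x) b B)

  max-≥ : ∀ b B → All (_≤ᵣ max b B) (b ∷ B)
  max-≥ b B = ⊥≤max b B ∷ xs≤max b B

  summands : Triple → ℝ × ℝ
  summands (a , b , _) = a , b

  sum : Triple → ℝ
  sum (_ , _ , c) = c

  summands-injective : ∀ {t t′} → IsSumTriple R A B C t → IsSumTriple R A B C t′ →
                       summands t ≡ summands t′ → t ≡ t′
  summands-injective (_ , _ , _ , refl) (_ , _ , _ , refl) refl = refl

  length≤|A|*|B| : Unique T → All (IsSumTriple R A B C) T → length T ≤ length A * length B
  length≤|A|*|B| {T} {A} {B} T-unique T-sums = subst (length T ≤_) (length-cartesianProduct A B)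
    (injectiveOn⇒length≤ summands T-unique summands∈A×B
      (λ t∈T t′∈T → summands-injective (All.lookup T-sums t∈T) (All.lookup T-sums t′∈T)))
    where
    summands∈A×B : ∀ {t} → t ∈ T → summands t ∈ cartesianProduct A B
    summands∈A×B t∈T with All.lookup T-sums t∈T
    ... | a∈A , b∈B , _ = ∈-cartesianProduct⁺ a∈A b∈B

  Extremal : ℝ → ℝ → Triple → Set
  Extremal a₀ b₀ (a , b , _) = a ≡ a₀ ⊎ b ≡ b₀

  extremal? : ∀ a₀ b₀ → Decidable (Extremal a₀ b₀)
  extremal? a₀ b₀ (a , b , _) = (a ≟ a₀) ⊎-dec (b ≟ b₀)

  extremal-summands-determined : All (a₀ ≤ᵣ_) A → All (_≤ᵣ b₀) B →
    a ∈ A → b ∈ B → a′ ∈ A → b′ ∈ B → a ≡ a₀ ⊎ b ≡ b₀ → a′ ≡ a₀ ⊎ b′ ≡ b₀ →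
    a +ᵣ b ≡ a′ +ᵣ b′ → a ≡ a′ × b ≡ b′
  extremal-summands-determined _    _    _   _   _    _    (inj₁ refl) (inj₁ refl) eq =
    refl , +ᵣ-cancelˡ _ eq
  extremal-summands-determined _    _    _   _   _    _    (inj₂ refl) (inj₂ refl) eq =
    +ᵣ-cancelʳ _ eq , refl
  extremal-summands-determined a₀≤A B≤b₀ _ b∈B a′∈A _ (inj₁ refl) (inj₂ refl) eq =
    +ᵣ-≡-squeeze (All.lookup a₀≤A a′∈A) (All.lookup B≤b₀ b∈B) eq
  extremal-summands-determined a₀≤A B≤b₀ a∈A _ _ b′∈B (inj₂ refl) (inj₁ refl) eq =
    let a′≡a , b′≡b = +ᵣ-≡-squeeze (All.lookup a₀≤A a∈A) (All.lookup B≤b₀ b′∈B) (sym eq)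
    in  sym a′≡a , sym b′≡b

  extremal-injective : All (a₀ ≤ᵣ_) A → All (_≤ᵣ b₀) B → ∀ {t t′} →
    IsSumTriple R A B C t → IsSumTriple R A B C t′ → Extremal a₀ b₀ t → Extremal a₀ b₀ t′ →
    sum t ≡ sum t′ → t ≡ t′
  extremal-injective a₀≤A B≤b₀ (a∈A , b∈B , _ , refl) (a′∈A , b′∈B , _ , refl) e e′ eq
    with extremal-summands-determined a₀≤A B≤b₀ a∈A b∈B a′∈A b′∈B e e′ eq
  ... | refl , refl = refl

  extremals nonExtremals : ℝ → ℝ → List Triple → List Triple
  extremals a₀ b₀ = filter (extremal? a₀ b₀)
  nonExtremals a₀ b₀ = filter (∁? (extremal? a₀ b₀))

  length≤|C|+|nonExtremals| : All (a₀ ≤ᵣ_) A → All (_≤ᵣ b₀) B → Unique T → All (IsSumTriple R A B C) T →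
    length T ≤ length C + length (nonExtremals a₀ b₀ T)
  length≤|C|+|nonExtremals| {a₀} {A} {b₀} {B} {T} {C} a₀≤A B≤b₀ T-unique T-sums = begin
    length T                                                    ≡⟨ length-filter+filter-∁ (extremal? a₀ b₀) T ⟨
    length (extremals a₀ b₀ T) + length (nonExtremals a₀ b₀ T)  ≤⟨ +-monoˡ-≤ _ |extremals|≤|C| ⟩
    length C + length (nonExtremals a₀ b₀ T)                    ∎
    where
    open ≤-Reasoning

    extremal-∈⁻ : ∀ {t} → t ∈ extremals a₀ b₀ T → t ∈ T × Extremal a₀ b₀ t
    extremal-∈⁻ = ∈-filter⁻ (extremal? a₀ b₀)

    sumTriple : ∀ {t} → t ∈ extremals a₀ b₀ T → IsSumTriple R A B C t
    sumTriple t∈ = All.lookup T-sums (proj₁ (extremal-∈⁻ t∈))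

    sum∈C : ∀ {t} → t ∈ extremals a₀ b₀ T → sum t ∈ C
    sum∈C t∈ with sumTriple t∈
    ... | _ , _ , c∈C , _ = c∈C

    |extremals|≤|C| : length (extremals a₀ b₀ T) ≤ length C
    |extremals|≤|C| = injectiveOn⇒length≤ sum (Unique.filter⁺ (extremal? a₀ b₀) T-unique) sum∈C
      (λ t∈ t′∈ → extremal-injective a₀≤A B≤b₀ (sumTriple t∈) (sumTriple t′∈)
        (proj₂ (extremal-∈⁻ t∈)) (proj₂ (extremal-∈⁻ t′∈)))

  nonExtremal-sumTriple : (p : a₀ ∈ A) (q : b₀ ∈ B) → ∀ {t} → IsSumTriple R A B C t →
    ¬ Extremal a₀ b₀ t → IsSumTriple R (A ─ p) (B ─ q) C t
  nonExtremal-sumTriple p q (a∈A , b∈B , c∈C , eq) ¬e =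
    ∈-─⁺ p a∈A (λ a≡a₀ → ¬e (inj₁ a≡a₀)) , ∈-─⁺ q b∈B (λ b≡b₀ → ¬e (inj₂ b≡b₀)) , c∈C , eq

  nonExtremals-sumTriples : (p : a₀ ∈ A) (q : b₀ ∈ B) → All (IsSumTriple R A B C) T →
    All (IsSumTriple R (A ─ p) (B ─ q) C) (nonExtremals a₀ b₀ T)
  nonExtremals-sumTriples {a₀} {b₀ = b₀} p q T-sums = All.tabulate λ t∈ →
    let t∈T , ¬e = ∈-filter⁻ (∁? (extremal? a₀ b₀)) t∈
    in  nonExtremal-sumTriple p q (All.lookup T-sums t∈T) ¬e

  SumTripleBound : List ℝ → List ℝ → List ℝ → Set
  SumTripleBound A B C = ∀ {T} → Unique T → All (IsSumTriple R A B C) T →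
    4 * length T + (length A + length B ∸ length C) ^ 2 ≤ 4 * (length A * length B) + 1

  excess≤1⇒sumTripleBound : length A + length B ≤ length C + 1 → SumTripleBound A B C
  excess≤1⇒sumTripleBound {A} {B} {C} |A|+|B|≤|C|+1 T-unique T-sums =
    +-mono-≤ (*-monoʳ-≤ 4 (length≤|A|*|B| T-unique T-sums))
             (^-monoˡ-≤ 2 (m≤n+o⇒m∸n≤o (length A + length B) (length C) |A|+|B|≤|C|+1))

  peel-sumTripleBound : (p : a₀ ∈ A) → All (a₀ ≤ᵣ_) A → (q : b₀ ∈ B) → All (_≤ᵣ b₀) B →
    SumTripleBound (A ─ p) (B ─ q) C → SumTripleBound A B C
  peel-sumTripleBound {a₀} {A} {b₀} {B} {C} p a₀≤A q B≤b₀ ih {T} T-unique T-sums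
    with length C ≤? length (A ─ p) + length (B ─ q)
  ... | yes |C|≤|A′|+|B′| =
    excess-step (length-─′ p) (length-─′ q) |C|≤|A′|+|B′|
      (length≤|C|+|nonExtremals| a₀≤A B≤b₀ T-unique T-sums)
      (ih (Unique.filter⁺ (∁? (extremal? a₀ b₀)) T-unique) (nonExtremals-sumTriples p q T-sums))
  ... | no |C|≰|A′|+|B′| =
    excess≤1⇒sumTripleBound (suc+suc≤+1 (length-─′ p) (length-─′ q) (≰⇒> |C|≰|A′|+|B′|)) T-unique T-sums

  sumTripleBound : ∀ n A B C → length A ≡ n → length A ⊔ length B ≤ length C → SumTripleBound A B C
  sumTripleBound _ [] B C _ |B|≤|C| = excess≤1⇒sumTripleBound (m≤n⇒m≤n+o 1 |B|≤|C|)
  sumTripleBound _ (_ ∷ _) [] C _ |A|≤|C| = excess≤1⇒sumTripleBound (+-mono-≤ |A|≤|C| z≤n)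
  sumTripleBound (suc n) (a ∷ A) (b ∷ B) C refl |A|⊔|B|≤|C| =
    peel-sumTripleBound a₀∈ (min-≤ a A) b₀∈ (max-≥ b B)
      (sumTripleBound n _ _ C (suc-injective (sym (length-─′ a₀∈)))
        (≤-trans (⊔-mono-≤ (length-─-≤ a₀∈) (length-─-≤ b₀∈)) |A|⊔|B|≤|C|))
    where
    a₀∈ = min-∈ a A
    b₀∈ = max-∈ b B

lemma2 : (R : RealNumbers) → (A B C : List (RealNumbers.ℝ R)) →
    Unique A → Unique B → Unique C →
    length A ⊔ length B ≤ length C → length C ≤ length A + length B →
    (T : List (RealNumbers.ℝ R × RealNumbers.ℝ R × RealNumbers.ℝ R)) →
    Unique T → All (IsSumTriple R A B C) T →
    4 * length T + (length A + length B ∸ length C) ^ 2 ≤ 4 * (length A * length B) + 1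
lemma2 R A B C _ _ _ |A|⊔|B|≤|C| _ T T-unique T-sums =
  sumTripleBound R (length A) A B C refl |A|⊔|B|≤|C| T-unique T-sums
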